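{- For every integer $\gamma\ge0$, the vector space $\mathcal{F}_\gamma$ of $\gamma$-edge valued binary trees, endowed with the operations $\prec_a,\succ_a$ ($a\in[\gamma]$) defined below, is the free $\gamma$-polydendriform algebra over one generator, the generator being the tree with exactly one internal node: $\mathcal{F}_\gamma$ is a $\gamma$-polydendriform algebra, and for every $\gamma$-polydendriform algebra $A$ and every $e\in A$ there is a unique linear map $\mathcal{F}_\gamma\to A$ commuting with all $\prec_a,\succ_a$ and sending the one-node tree to $e$.
   Context: $\mathbb{K}$ is a field of characteristic zero, $[n]=\{1,\dots,n\}$, $a\downarrow a'=\min(a,a')$, extended by $a\downarrow\infty=a=\infty\downarrow a$. A $\gamma$-polydendriform algebra is a $\mathbb{K}$-vector space with bilinear operations $\prec_a,\succ_a$, $a\in[\gamma]$, such that for all $x,y,z$ and $a,a'\in[\gamma]$: $(x\succ_{a'}y)\prec_a z=x\succ_{a'}(y\prec_a z)$; $(x\prec_{a'}y)\prec_a z=x\prec_{a\downarrow a'}(y\prec_a z)+x\prec_{a\downarrow a'}(y\succ_{a'}z)$; $(x\prec_{a'}y)\succ_{a\downarrow a'}z+(x\succ_a y)\succ_{a\downarrow a'}z=x\succ_a(y\succ_{a'}z)$. A $\gamma$-edge valued binary tree is a planar binary tree with at least one internal node (each internal node has a left and a right child, each being a leaf or an internal node) in which every edge joining two internal nodes is labeled by an element of $[\gamma]$; edges joining an internal node to a leaf are regarded as labeled by $\infty$. $\mathcal{F}_\gamma$ is the vector space with basis these trees. Write $\ell$ for the leaf and $N(x,t_1;y,t_2)$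 for the tree whose root has left subtree $t_1$ attached by an edge labeled $x$ and right subtree $t_2$ attached by an edge labeled $y$ ($t_i$ a tree or $\ell$; the label is $\infty$ when $t_i=\ell$), extended linearly in $t_1,t_2$. The operations are defined bilinearly and recursively: for any tree $s$, $s\prec_a\ell:=s$, $\ell\succ_a s:=s$, $\ell\prec_a s:=0$, $s\succ_a\ell:=0$; and for $t=N(x,t_1;y,t_2)$, $t\prec_a s:=N(x,t_1;z,t_2\prec_a s)+N(x,t_1;z,t_2\succ_y s)$ with $z=a\downarrow y$, $s\succ_a t:=N(z,s\succ_a t_1;y,t_2)+N(z,s\prec_x t_1;y,t_2)$ with $z=a\downarrow x$. -}

module Defs where

open import Level using (Level; _⊔_) renaming (suc to lsuc)
open import Data.Nat using (ℕ; zero; suc)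
open import Data.Fin using (Fin)
open import Data.Fin.Properties using () renaming (_≟_ to _≟ᶠ_)
open import Data.Fin using (zero; suc)
open import Data.List using (List; []; _∷_; _++_; map; concatMap)
open import Data.Product using (_×_; _,_; Σ; ∃)
open import Relation.Nullary using (¬_; Dec; yes; no)
open import Relation.Binary.PropositionalEquality using (_≡_; refl; cong; cong₂)
open import Algebra.Bundles using (CommutativeRing)
open import Algebra.Module.Bundles using (Module)

record Field (c ℓ : Level) : Set (lsuc (c ⊔ ℓ)) where
  field
    commutativeRing : CommutativeRing c ℓ
  open CommutativeRing commutativeRing public
  field
    1≉0     : ¬ (1# ≈ 0#)
    inverse : ∀ x → ¬ (x ≈ 0#) → Σ Carrier λ y → x * y ≈ 1#

module _ {c ℓ} (K : Field c ℓ) where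
  open Field K

  natK : ℕ → Carrier
  natK zero    = 0#
  natK (suc n) = 1# + natK n

  CharacteristicZero : Set ℓ
  CharacteristicZero = ∀ n → ¬ (natK (suc n) ≈ 0#)

_⊓_ : ∀ {γ} → Fin γ → Fin γ → Fin γ
zero  ⊓ _     = zero
suc _ ⊓ zero  = zero
suc a ⊓ suc b = suc (a ⊓ b)

-- γ-edge valued binary trees.  Labels in [γ] are represented by Fin γ
-- (i ↦ i+1, order preserving); an edge to a leaf carries no label (∞).

data Tree (γ : ℕ) : Set

data Child (γ : ℕ) : Set where
  leaf : Child γ
  edge : Fin γ → Tree γ → Child γ

data Tree γ where
  node : Child γ → Child γ → Tree γ

mutual
  _≟T_ : ∀ {γ} (s t : Tree γ) → Dec (s ≡ t)
  node a b ≟T node c d with a ≟C c | b ≟C d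
  ... | yes refl | yes refl = yes refl
  ... | no p | _ = no λ { refl → p refl }
  ... | yes _ | no q = no λ { refl → q refl }

  _≟C_ : ∀ {γ} (s t : Child γ) → Dec (s ≡ t)
  leaf ≟C leaf = yes refl
  leaf ≟C edge _ _ = no λ ()
  edge _ _ ≟C leaf = no λ ()
  edge a s ≟C edge b t with a ≟ᶠ b | s ≟T t
  ... | yes refl | yes refl = yes refl
  ... | no p | _ = no λ { refl → p refl }
  ... | yes _ | no q = no λ { refl → q refl }

-- The operations on basis trees; the result is a sum of trees, given as a
-- list (all coefficients are 1).
--   precT a t s  =  t ≺_a s
--   succT a s t  =  s ≻_a t
-- Unfolding the recursive definition (with ℓ ≺_a s = 0, ℓ ≻_a s = s and
-- a ↓ ∞ = a):
--   N(x,t1;ℓ) ≺_a s           = N(x,t1; a, s)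
--   N(x,t1;y,t2) ≺_a s        = N(x,t1; a↓y, t2 ≺_a s) + N(x,t1; a↓y, t2 ≻_y s)
--   s ≻_a N(ℓ;y,t2)           = N(a, s; y,t2)
--   s ≻_a N(x,t1;y,t2)        = N(a↓x, s ≻_a t1; y,t2) + N(a↓x, s ≺_x t1; y,t2)
mutual
  precT : ∀ {γ} → Fin γ → Tree γ → Tree γ → List (Tree γ)
  precT a (node c₁ leaf) s = node c₁ (edge a s) ∷ []
  precT a (node c₁ (edge y t₂)) s =
    map (λ u → node c₁ (edge (a ⊓ y) u)) (precT a t₂ s ++ succT y t₂ s)

  succT : ∀ {γ} → Fin γ → Tree γ → Tree γ → List (Tree γ)
  succT a s (node leaf c₂) = node (edge a s) c₂ ∷ []
  succT a s (node (edge x t₁) c₂) =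
    map (λ u → node (edge (a ⊓ x) u) c₂) (succT a s t₁ ++ precT x s t₁)

-- The vector space 𝓕_γ over K: finite formal linear combinations of trees,
-- identified when all coefficients agree.

module FreeSpace {c ℓ} (K : Field c ℓ) (γ : ℕ) where
  open Field K

  F : Set c
  F = List (Carrier × Tree γ)

  coeff : Tree γ → F → Carrier
  coeff t [] = 0#
  coeff t ((k , s) ∷ xs) with s ≟T t
  ... | yes _ = k + coeff t xs
  ... | no _  = coeff t xs

  _≈F_ : F → F → Set ℓ
  x ≈F y = ∀ t → coeff t x ≈ coeff t y

  _+F_ : F → F → F
  x +F y = x ++ y

  0F : F
  0F = []

  _*F_ : Carrier → F → F
  k *F x = map (λ { (d , t) → (k * d , t) }) x

  _*Fʳ_ : F → Carrier → F
  x *Fʳ k = k *F x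

  -F_ : F → F
  -F x = map (λ { (d , t) → (- d , t) }) x

  bilin : (Tree γ → Tree γ → List (Tree γ)) → F → F → F
  bilin op x y =
    concatMap (λ { (d , t) →
      concatMap (λ { (e , s) → map (λ u → (d * e , u)) (op t s) }) y }) x

  precF : Fin γ → F → F → F
  precF a = bilin (precT a)

  succF : Fin γ → F → F → F
  succF a = bilin (succT a)

  gen : F
  gen = (1# , node leaf leaf) ∷ []

module _ {c ℓ m ℓm} (K : Field c ℓ) (γ : ℕ) {M : Set m}
         (_≈ᴹ_ : M → M → Set ℓm) (_+ᴹ_ : M → M → M)
         (_*ᴹ_ : Field.Carrier K → M → M) where
  open Field K using (Carrier)

  _↓_ : Fin γ → Fin γ → Fin γ
  a ↓ a' = a ⊓ a'

  IsBilinear : (M → M → M) → Set (c ⊔ m ⊔ ℓm)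
  IsBilinear _∘_ =
      (∀ {x x' y y'} → x ≈ᴹ x' → y ≈ᴹ y' → (x ∘ y) ≈ᴹ (x' ∘ y'))
    × (∀ x y z → ((x +ᴹ y) ∘ z) ≈ᴹ ((x ∘ z) +ᴹ (y ∘ z)))
    × (∀ x y z → (x ∘ (y +ᴹ z)) ≈ᴹ ((x ∘ y) +ᴹ (x ∘ z)))
    × (∀ (k : Carrier) x y → ((k *ᴹ x) ∘ y) ≈ᴹ (k *ᴹ (x ∘ y)))
    × (∀ (k : Carrier) x y → (x ∘ (k *ᴹ y)) ≈ᴹ (k *ᴹ (x ∘ y)))

  record IsPolydendriform (_≺_ _≻_ : Fin γ → M → M → M) : Set (c ⊔ m ⊔ ℓm) where
    field
      ≺-bilinear : ∀ a → IsBilinear (_≺_ a)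
      ≻-bilinear : ∀ a → IsBilinear (_≻_ a)
      axiom₁ : ∀ a a' x y z →
        _≺_ a (_≻_ a' x y) z ≈ᴹ _≻_ a' x (_≺_ a y z)
      axiom₂ : ∀ a a' x y z →
        _≺_ a (_≺_ a' x y) z ≈ᴹ
          (_≺_ (a ↓ a') x (_≺_ a y z) +ᴹ _≺_ (a ↓ a') x (_≻_ a' y z))
      axiom₃ : ∀ a a' x y z →
        (_≻_ (a ↓ a') (_≺_ a' x y) z +ᴹ _≻_ (a ↓ a') (_≻_ a x y) z) ≈ᴹ
          _≻_ a x (_≻_ a' y z)

record PolydendriformAlgebra {c ℓ} (K : Field c ℓ) (γ : ℕ) (m ℓm : Level)
       : Set (c ⊔ ℓ ⊔ lsuc (m ⊔ ℓm)) where
  field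
    module′ : Module (Field.commutativeRing K) m ℓm
  open Module module′ public
  field
    _≺_ _≻_ : Fin γ → Carrierᴹ → Carrierᴹ → Carrierᴹ
    isPolydendriform : IsPolydendriform K γ _≈ᴹ_ _+ᴹ_ _*ₗ_ _≺_ _≻_

module _ {c ℓ m ℓm} (K : Field c ℓ) (γ : ℕ)
         (A : PolydendriformAlgebra K γ m ℓm) where
  open FreeSpace K γ
  open PolydendriformAlgebra A

  IsMorphism : (F → Carrierᴹ) → Set (c ⊔ ℓ ⊔ ℓm)
  IsMorphism f =
      (∀ {x y} → x ≈F y → f x ≈ᴹ f y)
    × (∀ x y → f (x +F y) ≈ᴹ (f x +ᴹ f y))
    × (∀ k x → f (k *F x) ≈ᴹ (k *ₗ f x))
    × (∀ a x y → f (precF a x y) ≈ᴹ (_≺_ a (f x) (f y)))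
    × (∀ a x y → f (succF a x y) ≈ᴹ (_≻_ a (f x) (f y)))

-- On basis trees the operations produce lists of trees, and the three
-- polydendriform axioms already hold there up to permutation of these lists, by a
-- simultaneous induction that unfolds the recursive definitions of ≺ and ≻.  The rest is
-- linear algebra: evaluating Σ dᵢ tᵢ in a K-module as Σ dᵢ φ(tᵢ) is well defined on
-- ≈F-classes, and a Kronecker delta φ recovers the coefficients, so identities in 𝓕_γ
-- reduce to identities between lists of trees.  Every tree is obtained from the one-node
-- tree • by the grafts N(x,t₁;y,t₂) = t₁ ≻ₓ (• ≺ᵧ t₂); interpreting trees this way in A
-- gives a morphism, since the recursion defining ≺ and ≻ on trees is an instance of the
-- axioms of A, and the same decomposition forces uniqueness.

module Submission where

open import Defs
open import Level using (Level; _⊔_)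
open import Data.Nat using (ℕ; suc; _≤_; z≤n; s≤s)
open import Data.Nat.Properties using (m≤n⇒m≤1+n; ≤-refl; ≤-trans)
open import Data.Fin using (Fin; zero; suc)
open import Data.Product using (_×_; _,_; proj₁; proj₂; Σ)
open import Data.List using (List; []; _∷_; _++_; map; concatMap; length)
open import Data.List.Properties
  using (concatMap-++; concatMap-map; map-concatMap; concatMap-pure; ++-identityʳ)
open import Data.List.Relation.Binary.Permutation.Propositional as ↭
  using (_↭_; ↭-refl; ↭-sym; ↭-trans; ↭-reflexive; module PermutationReasoning)
open import Data.List.Relation.Binary.Permutation.Propositional.Properties
  using (map⁺; ++⁺; ++⁺ˡ; ++⁺ʳ; ++-comm; ++-assoc; shifts)
open import Relation.Nullary using (yes; no; contradiction)
open import Relation.Binary.PropositionalEquality as ≡ using (_≡_; _≢_)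
import Relation.Binary.Reasoning.Setoid as ≈-Reasoning
open import Algebra.Bundles using (CommutativeMonoid; AbelianGroup)
open import Algebra.Structures using (IsAbelianGroup)
open import Algebra.Morphism.Structures using (IsGroupMonomorphism)
import Algebra.Morphism.GroupMonomorphism as GroupMonomorphism
import Algebra.Construct.Pointwise as Pointwise
import Algebra.Properties.AbelianGroup as AbelianGroupProperties
import Algebra.Properties.Group as GroupProperties
import Algebra.Properties.CommutativeSemigroup as CommutativeSemigroupProperties
open import Algebra.Module.Bundles using (Module)
open import Algebra.Module.Structures using (IsModule)
open import Algebra.Module.Structures.Biased using (IsModuleFromLeft)
import Algebra.Module.Construct.TensorUnit as TensorUnit

⊓-comm : ∀ {n} (a b : Fin n) → a ⊓ b ≡ b ⊓ a
⊓-comm zero    zero    = ≡.refl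
⊓-comm zero    (suc b) = ≡.refl
⊓-comm (suc a) zero    = ≡.refl
⊓-comm (suc a) (suc b) = ≡.cong suc (⊓-comm a b)

⊓-assoc : ∀ {n} (a b c : Fin n) → (a ⊓ b) ⊓ c ≡ a ⊓ (b ⊓ c)
⊓-assoc zero    b       c       = ≡.refl
⊓-assoc (suc a) zero    c       = ≡.refl
⊓-assoc (suc a) (suc b) zero    = ≡.refl
⊓-assoc (suc a) (suc b) (suc c) = ≡.cong suc (⊓-assoc a b c)

private
  variable
    A B C : Set

concatMap-++-↭ : (f g : A → List B) (xs : List A) →
                 concatMap (λ x → f x ++ g x) xs ↭ concatMap f xs ++ concatMap g xs
concatMap-++-↭ f g []       = ↭-refl
concatMap-++-↭ f g (x ∷ xs) = begin
  (f x ++ g x) ++ concatMap (λ x → f x ++ g x) xs  ↭⟨ ++-assoc (f x) (g x) _ ⟩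
  f x ++ g x ++ concatMap (λ x → f x ++ g x) xs    ↭⟨ ++⁺ˡ (f x) (++⁺ˡ (g x) (concatMap-++-↭ f g xs)) ⟩
  f x ++ g x ++ concatMap f xs ++ concatMap g xs   ↭⟨ ++⁺ˡ (f x) (shifts (g x) (concatMap f xs)) ⟩
  f x ++ concatMap f xs ++ g x ++ concatMap g xs   ↭⟨ ↭-sym (++-assoc (f x) (concatMap f xs) _) ⟩
  (f x ++ concatMap f xs) ++ g x ++ concatMap g xs ∎
  where open PermutationReasoning

concatMap-map-++-↭ : (h : B → C) (f g : A → List B) (xs : List A) →
  concatMap (λ x → map h (f x ++ g x)) xs ↭ map h (concatMap f xs ++ concatMap g xs)
concatMap-map-++-↭ h f g xs = ↭-trans
  (↭-reflexive (≡.sym (map-concatMap h (λ x → f x ++ g x) xs)))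
  (map⁺ h (concatMap-++-↭ f g xs))

concatMap-singleton : (f : A → B) (xs : List A) → concatMap (λ x → f x ∷ []) xs ≡ map f xs
concatMap-singleton f xs = ≡.trans (≡.sym (concatMap-map (_∷ []) f xs)) (concatMap-pure (map f xs))

concatMap-map-comm : (h : A → B → C) (xs : List A) (ys : List B) →
  concatMap (λ x → map (h x) ys) xs ↭ concatMap (λ y → map (λ x → h x y) xs) ys
concatMap-map-comm h []       ys = ↭-reflexive (≡.sym (concatMap-[] ys))
  where
  concatMap-[] : ∀ (ys : List B) → concatMap (λ _ → []) ys ≡ []
  concatMap-[] []       = ≡.refl
  concatMap-[] (_ ∷ ys) = concatMap-[] ys
concatMap-map-comm h (x ∷ xs) ys = begin
  map (h x) ys ++ concatMap (λ x → map (h x) ys) xs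
    ↭⟨ ++⁺ˡ (map (h x) ys) (concatMap-map-comm h xs ys) ⟩
  map (h x) ys ++ concatMap (λ y → map (λ x → h x y) xs) ys
    ≡⟨ ≡.cong (_++ _) (≡.sym (concatMap-singleton (h x) ys)) ⟩
  concatMap (λ y → h x y ∷ []) ys ++ concatMap (λ y → map (λ x → h x y) xs) ys
    ↭⟨ ↭-sym (concatMap-++-↭ (λ y → h x y ∷ []) (λ y → map (λ x → h x y) xs) ys) ⟩
  concatMap (λ y → h x y ∷ map (λ x → h x y) xs) ys ∎
  where open PermutationReasoning

module _ {γ : ℕ} where

  precTˡ : Fin γ → List (Tree γ) → Tree γ → List (Tree γ)
  precTˡ a us w = concatMap (λ u → precT a u w) us

  succTˡ : Fin γ → List (Tree γ) → Tree γ → List (Tree γ)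
  succTˡ a us w = concatMap (λ u → succT a u w) us

  precTʳ : Fin γ → Tree γ → List (Tree γ) → List (Tree γ)
  precTʳ a u ws = concatMap (precT a u) ws

  succTʳ : Fin γ → Tree γ → List (Tree γ) → List (Tree γ)
  succTʳ a u ws = concatMap (succT a u) ws

  axiom₁ᵀ : ∀ a a' (x y z : Tree γ) → precTˡ a (succT a' x y) z ↭ succTʳ a' x (precT a y z)
  axiom₁ᵀ a a' x (node leaf leaf) z = ↭-refl
  axiom₁ᵀ a a' x (node leaf (edge q y₂)) z = ↭-reflexive (≡.trans
    (++-identityʳ _)
    (≡.sym (≡.trans (concatMap-map (succT a' x) _ (precT a y₂ z ++ succT q y₂ z)) (concatMap-singleton _ _))))
  axiom₁ᵀ a a' x (node (edge p y₁) leaf) z = ↭-reflexive (≡.trans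
    (≡.trans (concatMap-map (λ u → precT a u z) _ (succT a' x y₁ ++ precT p x y₁)) (concatMap-singleton _ _))
    (≡.sym (++-identityʳ _)))
  axiom₁ᵀ a a' x (node (edge p y₁) (edge q y₂)) z = begin
    precTˡ a (map (λ u → node (edge (a' ⊓ p) u) (edge q y₂)) us) z
      ≡⟨ concatMap-map (λ u → precT a u z) _ us ⟩
    concatMap (λ u → map (λ v → node (edge (a' ⊓ p) u) (edge (a ⊓ q) v)) vs) us
      ↭⟨ concatMap-map-comm (λ u v → node (edge (a' ⊓ p) u) (edge (a ⊓ q) v)) us vs ⟩
    concatMap (λ v → map (λ u → node (edge (a' ⊓ p) u) (edge (a ⊓ q) v)) us) vs
      ≡⟨ ≡.sym (concatMap-map (succT a' x) _ vs) ⟩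
    succTʳ a' x (map (λ v → node (edge p y₁) (edge (a ⊓ q) v)) vs) ∎
    where
    open PermutationReasoning
    us = succT a' x y₁ ++ precT p x y₁
    vs = precT a y₂ z ++ succT q y₂ z

  mutual
    axiom₂ᵀ : ∀ a a' (x y z : Tree γ) →
      precTˡ a (precT a' x y) z ↭ precTʳ (a ⊓ a') x (precT a y z ++ succT a' y z)
    axiom₂ᵀ a a' (node c leaf) y z = ↭-reflexive (≡.trans
      (++-identityʳ _) (≡.sym (concatMap-singleton _ (precT a y z ++ succT a' y z))))
    axiom₂ᵀ a a' (node c (edge q x₂)) y z = ↭-trans lhs (↭-sym rhs)
      where
      open PermutationReasoning
      us = precT a' x₂ y ++ succT q x₂ y
      vs = precT a y z ++ succT a' y z
      graft : Fin γ → Tree γ → Tree γ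
      graft b u = node c (edge b u)
      common = map (graft ((a ⊓ a') ⊓ q))
        ((precTʳ (a ⊓ a') x₂ vs ++ succTʳ q x₂ (precT a y z)) ++ succTʳ q x₂ (succT a' y z))
      lhs : precTˡ a (map (graft (a' ⊓ q)) us) z ↭ common
      lhs = begin
        precTˡ a (map (graft (a' ⊓ q)) us) z
          ≡⟨ concatMap-map (λ u → precT a u z) _ us ⟩
        concatMap (λ u → map (graft (a ⊓ (a' ⊓ q))) (precT a u z ++ succT (a' ⊓ q) u z)) us
          ↭⟨ concatMap-map-++-↭ (graft (a ⊓ (a' ⊓ q))) _ _ us ⟩
        map (graft (a ⊓ (a' ⊓ q))) (precTˡ a us z ++ succTˡ (a' ⊓ q) us z)
          ≡⟨ ≡.cong₂ (λ b ws → map (graft b) (ws ++ succTˡ (a' ⊓ q) us z))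
                   (≡.sym (⊓-assoc a a' q)) (concatMap-++ _ (precT a' x₂ y) (succT q x₂ y)) ⟩
        map (graft ((a ⊓ a') ⊓ q)) ((precTˡ a (precT a' x₂ y) z ++ precTˡ a (succT q x₂ y) z)
                                      ++ succTˡ (a' ⊓ q) us z)
          ≡⟨ ≡.cong (λ b → map (graft ((a ⊓ a') ⊓ q))
                           ((precTˡ a (precT a' x₂ y) z ++ precTˡ a (succT q x₂ y) z) ++ succTˡ b us z))
                  (⊓-comm a' q) ⟩
        map (graft ((a ⊓ a') ⊓ q)) ((precTˡ a (precT a' x₂ y) z ++ precTˡ a (succT q x₂ y) z)
                                      ++ succTˡ (q ⊓ a') us z)
          ↭⟨ map⁺ _ (++⁺ (++⁺ (axiom₂ᵀ a a' x₂ y z) (axiom₁ᵀ a q x₂ y z)) (axiom₃ᵀ q a' x₂ y z)) ⟩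
        common ∎
      rhs : precTʳ (a ⊓ a') (node c (edge q x₂)) vs ↭ common
      rhs = begin
        concatMap (λ v → map (graft ((a ⊓ a') ⊓ q)) (precT (a ⊓ a') x₂ v ++ succT q x₂ v)) vs
          ↭⟨ concatMap-map-++-↭ (graft ((a ⊓ a') ⊓ q)) _ _ vs ⟩
        map (graft ((a ⊓ a') ⊓ q)) (precTʳ (a ⊓ a') x₂ vs ++ succTʳ q x₂ vs)
          ≡⟨ ≡.cong (λ ws → map (graft ((a ⊓ a') ⊓ q)) (precTʳ (a ⊓ a') x₂ vs ++ ws))
                  (concatMap-++ _ (precT a y z) (succT a' y z)) ⟩
        map (graft ((a ⊓ a') ⊓ q)) (precTʳ (a ⊓ a') x₂ vs ++ (succTʳ q x₂ (precT a y z)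
                                                            ++ succTʳ q x₂ (succT a' y z)))
          ↭⟨ map⁺ _ (↭-sym (++-assoc (precTʳ (a ⊓ a') x₂ vs) _ _)) ⟩
        common ∎

    axiom₃ᵀ : ∀ a a' (x y z : Tree γ) →
      succTˡ (a ⊓ a') (precT a' x y ++ succT a x y) z ↭ succTʳ a x (succT a' y z)
    axiom₃ᵀ a a' x y (node leaf c) = begin
      succTˡ (a ⊓ a') (precT a' x y ++ succT a x y) (node leaf c)
        ≡⟨ concatMap-singleton _ (precT a' x y ++ succT a x y) ⟩
      map (λ u → node (edge (a ⊓ a') u) c) (precT a' x y ++ succT a x y)
        ↭⟨ map⁺ _ (++-comm (precT a' x y) (succT a x y)) ⟩
      map (λ u → node (edge (a ⊓ a') u) c) (succT a x y ++ precT a' x y)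
        ≡⟨ ≡.sym (++-identityʳ _) ⟩
      succTʳ a x (succT a' y (node leaf c)) ∎
      where open PermutationReasoning
    axiom₃ᵀ a a' x y (node (edge p z₁) c) = ↭-trans lhs (↭-sym rhs)
      where
      open PermutationReasoning
      us = precT a' x y ++ succT a x y
      ss = succT a' y z₁
      ps = precT p y z₁
      graft : Fin γ → Tree γ → Tree γ
      graft b u = node (edge b u) c
      common = map (graft (a ⊓ (a' ⊓ p)))
        (succTʳ a x ss ++ (precTʳ (a' ⊓ p) x (ss ++ ps) ++ succTʳ a x ps))
      lhs : succTˡ (a ⊓ a') us (node (edge p z₁) c) ↭ common
      lhs = begin
        concatMap (λ u → map (graft ((a ⊓ a') ⊓ p)) (succT (a ⊓ a') u z₁ ++ precT p u z₁)) us
          ↭⟨ concatMap-map-++-↭ (graft ((a ⊓ a') ⊓ p)) _ _ us ⟩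
        map (graft ((a ⊓ a') ⊓ p)) (succTˡ (a ⊓ a') us z₁ ++ precTˡ p us z₁)
          ≡⟨ ≡.cong₂ (λ b ws → map (graft b) (succTˡ (a ⊓ a') us z₁ ++ ws))
                   (⊓-assoc a a' p) (concatMap-++ _ (precT a' x y) (succT a x y)) ⟩
        map (graft (a ⊓ (a' ⊓ p)))
            (succTˡ (a ⊓ a') us z₁ ++ (precTˡ p (precT a' x y) z₁ ++ precTˡ p (succT a x y) z₁))
          ↭⟨ map⁺ _ (++⁺ (axiom₃ᵀ a a' x y z₁) (++⁺ (axiom₂ᵀ p a' x y z₁) (axiom₁ᵀ p a x y z₁))) ⟩
        map (graft (a ⊓ (a' ⊓ p))) (succTʳ a x ss ++ (precTʳ (p ⊓ a') x (ps ++ ss) ++ succTʳ a x ps))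
          ≡⟨ ≡.cong (λ b → map (graft (a ⊓ (a' ⊓ p))) (succTʳ a x ss ++ (precTʳ b x (ps ++ ss) ++ _)))
                  (⊓-comm p a') ⟩
        map (graft (a ⊓ (a' ⊓ p))) (succTʳ a x ss ++ (precTʳ (a' ⊓ p) x (ps ++ ss) ++ succTʳ a x ps))
          ≡⟨ ≡.cong (λ ws → map (graft (a ⊓ (a' ⊓ p))) (succTʳ a x ss ++ (ws ++ succTʳ a x ps)))
                  (concatMap-++ _ ps ss) ⟩
        map (graft (a ⊓ (a' ⊓ p)))
            (succTʳ a x ss ++ ((precTʳ (a' ⊓ p) x ps ++ precTʳ (a' ⊓ p) x ss) ++ succTʳ a x ps))
          ↭⟨ map⁺ _ (++⁺ˡ (succTʳ a x ss) (++⁺ʳ _ (++-comm (precTʳ (a' ⊓ p) x ps) _))) ⟩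
        map (graft (a ⊓ (a' ⊓ p)))
            (succTʳ a x ss ++ ((precTʳ (a' ⊓ p) x ss ++ precTʳ (a' ⊓ p) x ps) ++ succTʳ a x ps))
          ≡⟨ ≡.cong (λ ws → map (graft (a ⊓ (a' ⊓ p))) (succTʳ a x ss ++ (ws ++ succTʳ a x ps)))
                  (≡.sym (concatMap-++ _ ss ps)) ⟩
        common ∎
      rhs : succTʳ a x (map (graft (a' ⊓ p)) (ss ++ ps)) ↭ common
      rhs = begin
        succTʳ a x (map (graft (a' ⊓ p)) (ss ++ ps))
          ≡⟨ concatMap-map (succT a x) _ (ss ++ ps) ⟩
        concatMap (λ v → map (graft (a ⊓ (a' ⊓ p))) (succT a x v ++ precT (a' ⊓ p) x v)) (ss ++ ps)
          ↭⟨ concatMap-map-++-↭ (graft (a ⊓ (a' ⊓ p))) _ _ (ss ++ ps) ⟩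
        map (graft (a ⊓ (a' ⊓ p))) (succTʳ a x (ss ++ ps) ++ precTʳ (a' ⊓ p) x (ss ++ ps))
          ≡⟨ ≡.cong (λ ws → map (graft (a ⊓ (a' ⊓ p))) (ws ++ precTʳ (a' ⊓ p) x (ss ++ ps)))
                  (concatMap-++ _ ss ps) ⟩
        map (graft (a ⊓ (a' ⊓ p))) ((succTʳ a x ss ++ succTʳ a x ps) ++ precTʳ (a' ⊓ p) x (ss ++ ps))
          ↭⟨ map⁺ _ (↭-trans (++-assoc (succTʳ a x ss) _ _) (++⁺ˡ (succTʳ a x ss) (++-comm (succTʳ a x ps) _))) ⟩
        common ∎

module Evaluation {c ℓ m ℓm} (K : Field c ℓ) (γ : ℕ)
                  (M : Module (Field.commutativeRing K) m ℓm) where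
  open Field K
  open FreeSpace K γ
  open Module M
  open AbelianGroupProperties +ᴹ-abelianGroup using (⁻¹-∙-comm; ε⁻¹≈ε; inverseʳ-unique)
  open CommutativeSemigroupProperties (CommutativeMonoid.commutativeSemigroup +ᴹ-commutativeMonoid)
    using (interchange)
  open ≈-Reasoning ≈ᴹ-setoid

  sumᴹ : (Tree γ → Carrierᴹ) → List (Tree γ) → Carrierᴹ
  sumᴹ φ []       = 0ᴹ
  sumᴹ φ (t ∷ ts) = φ t +ᴹ sumᴹ φ ts

  eval : (Tree γ → Carrierᴹ) → F → Carrierᴹ
  eval φ []            = 0ᴹ
  eval φ ((d , t) ∷ x) = d *ₗ φ t +ᴹ eval φ x

  record IsLinear (h : Carrierᴹ → Carrierᴹ) : Set (c ⊔ m ⊔ ℓm) where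
    field
      congᴹ   : ∀ {u v} → u ≈ᴹ v → h u ≈ᴹ h v
      +ᴹ-homo : ∀ u v → h (u +ᴹ v) ≈ᴹ h u +ᴹ h v
      *ₗ-homo : ∀ k u → h (k *ₗ u) ≈ᴹ k *ₗ h u

    0ᴹ-homo : h 0ᴹ ≈ᴹ 0ᴹ
    0ᴹ-homo = begin
      h 0ᴹ          ≈⟨ congᴹ (*ₗ-zeroˡ 0ᴹ) ⟨
      h (0# *ₗ 0ᴹ)  ≈⟨ *ₗ-homo 0# 0ᴹ ⟩
      0# *ₗ h 0ᴹ    ≈⟨ *ₗ-zeroˡ (h 0ᴹ) ⟩
      0ᴹ            ∎

  ∘-isLinear : ∀ {g h} → IsLinear g → IsLinear h → IsLinear (λ u → g (h u))
  ∘-isLinear G H = record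
    { congᴹ   = λ p → G.congᴹ (H.congᴹ p)
    ; +ᴹ-homo = λ u v → ≈ᴹ-trans (G.congᴹ (H.+ᴹ-homo u v)) (G.+ᴹ-homo _ _)
    ; *ₗ-homo = λ k u → ≈ᴹ-trans (G.congᴹ (H.*ₗ-homo k u)) (G.*ₗ-homo k _)
    }
    where
    module G = IsLinear G
    module H = IsLinear H

  sumᴹ-++ : ∀ φ ts us → sumᴹ φ (ts ++ us) ≈ᴹ sumᴹ φ ts +ᴹ sumᴹ φ us
  sumᴹ-++ φ []       us = ≈ᴹ-sym (+ᴹ-identityˡ _)
  sumᴹ-++ φ (t ∷ ts) us = ≈ᴹ-trans (+ᴹ-congˡ (sumᴹ-++ φ ts us)) (≈ᴹ-sym (+ᴹ-assoc _ _ _))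

  sumᴹ-↭ : ∀ φ {ts us} → ts ↭ us → sumᴹ φ ts ≈ᴹ sumᴹ φ us
  sumᴹ-↭ φ ↭.refl         = ≈ᴹ-refl
  sumᴹ-↭ φ (↭.prep t p)   = +ᴹ-congˡ (sumᴹ-↭ φ p)
  sumᴹ-↭ φ (↭.swap {ts} {us} t u p) = begin
    φ t +ᴹ (φ u +ᴹ sumᴹ φ ts)  ≈⟨ +ᴹ-assoc _ _ _ ⟨
    (φ t +ᴹ φ u) +ᴹ sumᴹ φ ts  ≈⟨ +ᴹ-cong (+ᴹ-comm _ _) (sumᴹ-↭ φ p) ⟩
    (φ u +ᴹ φ t) +ᴹ sumᴹ φ us  ≈⟨ +ᴹ-assoc _ _ _ ⟩
    φ u +ᴹ (φ t +ᴹ sumᴹ φ us)  ∎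
  sumᴹ-↭ φ (↭.trans p q)  = ≈ᴹ-trans (sumᴹ-↭ φ p) (sumᴹ-↭ φ q)

  sumᴹ-concatMap : ∀ φ (f : Tree γ → List (Tree γ)) ts →
                   sumᴹ φ (concatMap f ts) ≈ᴹ sumᴹ (λ u → sumᴹ φ (f u)) ts
  sumᴹ-concatMap φ f []       = ≈ᴹ-refl
  sumᴹ-concatMap φ f (t ∷ ts) =
    ≈ᴹ-trans (sumᴹ-++ φ (f t) (concatMap f ts)) (+ᴹ-congˡ (sumᴹ-concatMap φ f ts))

  sumᴹ-map : ∀ φ (f : Tree γ → Tree γ) ts → sumᴹ φ (map f ts) ≈ᴹ sumᴹ (λ u → φ (f u)) ts
  sumᴹ-map φ f []       = ≈ᴹ-refl
  sumᴹ-map φ f (t ∷ ts) = +ᴹ-congˡ (sumᴹ-map φ f ts)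

  sumᴹ-linear : ∀ {h} → IsLinear h → ∀ φ ts → sumᴹ (λ u → h (φ u)) ts ≈ᴹ h (sumᴹ φ ts)
  sumᴹ-linear H φ []       = ≈ᴹ-sym (IsLinear.0ᴹ-homo H)
  sumᴹ-linear H φ (t ∷ ts) =
    ≈ᴹ-trans (+ᴹ-congˡ (sumᴹ-linear H φ ts)) (≈ᴹ-sym (IsLinear.+ᴹ-homo H _ _))

  eval-linear : ∀ {h} → IsLinear h → ∀ φ x → eval (λ u → h (φ u)) x ≈ᴹ h (eval φ x)
  eval-linear H φ []            = ≈ᴹ-sym (IsLinear.0ᴹ-homo H)
  eval-linear {h} H φ ((d , t) ∷ x) = begin
    d *ₗ h (φ t) +ᴹ eval (λ u → h (φ u)) x  ≈⟨ +ᴹ-cong (≈ᴹ-sym (IsLinear.*ₗ-homo H d (φ t)))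
                                                      (eval-linear H φ x) ⟩
    h (d *ₗ φ t) +ᴹ h (eval φ x)            ≈⟨ IsLinear.+ᴹ-homo H _ _ ⟨
    h (d *ₗ φ t +ᴹ eval φ x)                ∎

  eval-++ : ∀ φ x y → eval φ (x +F y) ≈ᴹ eval φ x +ᴹ eval φ y
  eval-++ φ []            y = ≈ᴹ-sym (+ᴹ-identityˡ _)
  eval-++ φ ((d , t) ∷ x) y = ≈ᴹ-trans (+ᴹ-congˡ (eval-++ φ x y)) (≈ᴹ-sym (+ᴹ-assoc _ _ _))

  eval-*F : ∀ φ k x → eval φ (k *F x) ≈ᴹ k *ₗ eval φ x
  eval-*F φ k []            = ≈ᴹ-sym (*ₗ-zeroʳ k)
  eval-*F φ k ((d , t) ∷ x) = begin
    (k * d) *ₗ φ t +ᴹ eval φ (k *F x)  ≈⟨ +ᴹ-cong (*ₗ-assoc k d (φ t)) (eval-*F φ k x) ⟩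
    k *ₗ (d *ₗ φ t) +ᴹ k *ₗ eval φ x   ≈⟨ *ₗ-distribˡ k _ _ ⟨
    k *ₗ (d *ₗ φ t +ᴹ eval φ x)        ∎

  eval-negate : ∀ φ x → eval φ (-F x) ≈ᴹ -ᴹ eval φ x
  eval-negate φ []            = ≈ᴹ-sym (ε⁻¹≈ε)
  eval-negate φ ((d , t) ∷ x) = begin
    (- d) *ₗ φ t +ᴹ eval φ (-F x)     ≈⟨ +ᴹ-cong -‿*ₗ (eval-negate φ x) ⟩
    -ᴹ (d *ₗ φ t) +ᴹ -ᴹ eval φ x      ≈⟨ ⁻¹-∙-comm _ _ ⟩
    -ᴹ (d *ₗ φ t +ᴹ eval φ x)         ∎
    where
    -‿*ₗ : (- d) *ₗ φ t ≈ᴹ -ᴹ (d *ₗ φ t)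
    -‿*ₗ = inverseʳ-unique (d *ₗ φ t) ((- d) *ₗ φ t) (begin
      d *ₗ φ t +ᴹ (- d) *ₗ φ t  ≈⟨ *ₗ-distribʳ (φ t) d (- d) ⟨
      (d + - d) *ₗ φ t          ≈⟨ *ₗ-congʳ (-‿inverseʳ d) ⟩
      0# *ₗ φ t                 ≈⟨ *ₗ-zeroˡ (φ t) ⟩
      0ᴹ                        ∎)

  eval-cong : ∀ {φ ψ} → (∀ t → φ t ≈ᴹ ψ t) → ∀ x → eval φ x ≈ᴹ eval ψ x
  eval-cong p []            = ≈ᴹ-refl
  eval-cong p ((d , t) ∷ x) = +ᴹ-cong (*ₗ-congˡ (p t)) (eval-cong p x)

  eval-0ᴹ : ∀ x → eval (λ _ → 0ᴹ) x ≈ᴹ 0ᴹ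
  eval-0ᴹ []            = ≈ᴹ-refl
  eval-0ᴹ ((d , t) ∷ x) = ≈ᴹ-trans (+ᴹ-cong (*ₗ-zeroʳ d) (eval-0ᴹ x)) (+ᴹ-identityˡ 0ᴹ)

  eval-+ᴹ : ∀ φ ψ x → eval (λ t → φ t +ᴹ ψ t) x ≈ᴹ eval φ x +ᴹ eval ψ x
  eval-+ᴹ φ ψ []            = ≈ᴹ-sym (+ᴹ-identityˡ 0ᴹ)
  eval-+ᴹ φ ψ ((d , t) ∷ x) =
    ≈ᴹ-trans (+ᴹ-cong (*ₗ-distribˡ d (φ t) (ψ t)) (eval-+ᴹ φ ψ x)) (interchange _ _ _ _)

  *ₗ-isLinear : ∀ k → IsLinear (k *ₗ_)
  *ₗ-isLinear k = record
    { congᴹ   = *ₗ-congˡ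
    ; +ᴹ-homo = *ₗ-distribˡ k
    ; *ₗ-homo = λ d u → *ₗ-comm k d u
    }

  eval-sumᴹ : ∀ (ψ : Tree γ → Tree γ → Carrierᴹ) ts z →
              sumᴹ (λ t → eval (ψ t) z) ts ≈ᴹ eval (λ w → sumᴹ (λ t → ψ t w) ts) z
  eval-sumᴹ ψ []       z = ≈ᴹ-sym (eval-0ᴹ z)
  eval-sumᴹ ψ (t ∷ ts) z = ≈ᴹ-trans (+ᴹ-congˡ (eval-sumᴹ ψ ts z)) (≈ᴹ-sym (eval-+ᴹ (ψ t) _ z))

  eval-concatMap : ∀ φ (g : Carrier × Tree γ → F) (ψ : Tree γ → Carrierᴹ) →
    (∀ d t → eval φ (g (d , t)) ≈ᴹ d *ₗ ψ t) → ∀ x → eval φ (concatMap g x) ≈ᴹ eval ψ x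
  eval-concatMap φ g ψ p []            = ≈ᴹ-refl
  eval-concatMap φ g ψ p ((d , t) ∷ x) =
    ≈ᴹ-trans (eval-++ φ (g (d , t)) (concatMap g x)) (+ᴹ-cong (p d t) (eval-concatMap φ g ψ p x))

  eval-scaled : ∀ φ k ts → eval φ (map (λ u → (k , u)) ts) ≈ᴹ k *ₗ sumᴹ φ ts
  eval-scaled φ k []       = ≈ᴹ-sym (*ₗ-zeroʳ k)
  eval-scaled φ k (t ∷ ts) = ≈ᴹ-trans (+ᴹ-congˡ (eval-scaled φ k ts)) (≈ᴹ-sym (*ₗ-distribˡ k _ _))

  eval-bilin : ∀ φ (op : Tree γ → Tree γ → List (Tree γ)) x y →
    eval φ (bilin op x y) ≈ᴹ eval (λ u → eval (λ v → sumᴹ φ (op u v)) y) x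
  eval-bilin φ op x y = eval-concatMap φ _ _ (λ d t → ≈ᴹ-trans
    (eval-concatMap φ _ (λ s → d *ₗ sumᴹ φ (op t s)) (λ e s → begin
      eval φ (map (λ u → (d * e , u)) (op t s))  ≈⟨ eval-scaled φ (d * e) (op t s) ⟩
      (d * e) *ₗ sumᴹ φ (op t s)                ≈⟨ *ₗ-congʳ (*-comm d e) ⟩
      (e * d) *ₗ sumᴹ φ (op t s)                ≈⟨ *ₗ-assoc e d _ ⟩
      e *ₗ (d *ₗ sumᴹ φ (op t s))               ∎) y)
    (eval-linear (*ₗ-isLinear d) (λ s → sumᴹ φ (op t s)) y)) x

  eval₃ : (Tree γ → Tree γ → Tree γ → List (Tree γ)) → (Tree γ → Carrierᴹ) → F → F → F → Carrierᴹ
  eval₃ Θ φ x y z = eval (λ u → eval (λ v → eval (λ w → sumᴹ φ (Θ u v w)) z) y) x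

  eval₃-↭ : ∀ {Θ Θ'} → (∀ u v w → Θ u v w ↭ Θ' u v w) → ∀ φ x y z → eval₃ Θ φ x y z ≈ᴹ eval₃ Θ' φ x y z
  eval₃-↭ Θ↭Θ' φ x y z = eval-cong (λ u → eval-cong (λ v → eval-cong (λ w →
    sumᴹ-↭ φ (Θ↭Θ' u v w)) z) y) x

  eval₃-++ : ∀ Θ Θ' φ x y z →
    eval₃ (λ u v w → Θ u v w ++ Θ' u v w) φ x y z ≈ᴹ eval₃ Θ φ x y z +ᴹ eval₃ Θ' φ x y z
  eval₃-++ Θ Θ' φ x y z = ≈ᴹ-trans
    (eval-cong (λ u → ≈ᴹ-trans
      (eval-cong (λ v → ≈ᴹ-trans (eval-cong (λ w → sumᴹ-++ φ (Θ u v w) (Θ' u v w)) z) (eval-+ᴹ _ _ z)) y)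
      (eval-+ᴹ _ _ y)) x)
    (eval-+ᴹ _ _ x)

  eval-bilin-bilinˡ : ∀ (op op' : Tree γ → Tree γ → List (Tree γ)) φ x y z →
    eval φ (bilin op (bilin op' x y) z) ≈ᴹ eval₃ (λ u v w → concatMap (λ p → op p w) (op' u v)) φ x y z
  eval-bilin-bilinˡ op op' φ x y z = begin
    eval φ (bilin op (bilin op' x y) z)
      ≈⟨ eval-bilin φ op (bilin op' x y) z ⟩
    eval (λ p → eval (λ w → sumᴹ φ (op p w)) z) (bilin op' x y)
      ≈⟨ eval-bilin _ op' x y ⟩
    eval (λ u → eval (λ v → sumᴹ (λ p → eval (λ w → sumᴹ φ (op p w)) z) (op' u v)) y) x
      ≈⟨ eval-cong (λ u → eval-cong (λ v → ≈ᴹ-trans (eval-sumᴹ _ (op' u v) z)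
           (eval-cong (λ w → ≈ᴹ-sym (sumᴹ-concatMap φ (λ p → op p w) (op' u v))) z)) y) x ⟩
    eval₃ (λ u v w → concatMap (λ p → op p w) (op' u v)) φ x y z ∎

  eval-bilin-bilinʳ : ∀ (op op' : Tree γ → Tree γ → List (Tree γ)) φ x y z →
    eval φ (bilin op x (bilin op' y z)) ≈ᴹ eval₃ (λ u v w → concatMap (op u) (op' v w)) φ x y z
  eval-bilin-bilinʳ op op' φ x y z = ≈ᴹ-trans (eval-bilin φ op x (bilin op' y z))
    (eval-cong (λ u → ≈ᴹ-trans (eval-bilin (λ q → sumᴹ φ (op u q)) op' y z)
      (eval-cong (λ v → eval-cong (λ w → ≈ᴹ-sym (sumᴹ-concatMap φ (op u) (op' v w))) z) y)) x)

  module Bilinear {_∘_ : Carrierᴹ → Carrierᴹ → Carrierᴹ}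
                  (bilinear : IsBilinear K γ _≈ᴹ_ _+ᴹ_ _*ₗ_ _∘_) where

    ∘-cong : ∀ {u u' v v'} → u ≈ᴹ u' → v ≈ᴹ v' → (u ∘ v) ≈ᴹ (u' ∘ v')
    ∘-cong = proj₁ bilinear

    ∘-isLinearˡ : ∀ w → IsLinear (_∘ w)
    ∘-isLinearˡ w = record
      { congᴹ   = λ p → ∘-cong p ≈ᴹ-refl
      ; +ᴹ-homo = λ u v → proj₁ (proj₂ bilinear) u v w
      ; *ₗ-homo = λ k u → proj₁ (proj₂ (proj₂ (proj₂ bilinear))) k u w
      }

    ∘-isLinearʳ : ∀ w → IsLinear (w ∘_)
    ∘-isLinearʳ w = record
      { congᴹ   = ∘-cong ≈ᴹ-refl
      ; +ᴹ-homo = proj₁ (proj₂ (proj₂ bilinear)) w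
      ; *ₗ-homo = λ k v → proj₂ (proj₂ (proj₂ (proj₂ bilinear))) k w v
      }

    eval-∘ : ∀ ψ χ x y → eval (λ u → eval (λ v → ψ u ∘ χ v) y) x ≈ᴹ (eval ψ x ∘ eval χ y)
    eval-∘ ψ χ x y = ≈ᴹ-trans
      (eval-cong (λ u → eval-linear (∘-isLinearʳ (ψ u)) χ y) x)
      (eval-linear (∘-isLinearˡ (eval χ y)) ψ x)

    eval-bilin-∘ : ∀ φ {op : Tree γ → Tree γ → List (Tree γ)} →
      (∀ u v → sumᴹ φ (op u v) ≈ᴹ (φ u ∘ φ v)) → ∀ x y → eval φ (bilin op x y) ≈ᴹ (eval φ x ∘ eval φ y)
    eval-bilin-∘ φ {op} op≈∘ x y = begin
      eval φ (bilin op x y)                            ≈⟨ eval-bilin φ op x y ⟩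
      eval (λ u → eval (λ v → sumᴹ φ (op u v)) y) x    ≈⟨ eval-cong (λ u → eval-cong (op≈∘ u) y) x ⟩
      eval (λ u → eval (λ v → φ u ∘ φ v) y) x          ≈⟨ eval-∘ φ φ x y ⟩
      (eval φ x ∘ eval φ y)                            ∎

module Coefficients {c ℓ} (K : Field c ℓ) (γ : ℕ) where
  open Field K
  open FreeSpace K γ
  module Scalar = Evaluation K γ TensorUnit.⟨module⟩
  open Scalar using (eval)

  δ : Tree γ → Tree γ → Carrier
  δ t u with u ≟T t
  ... | yes _ = 1#
  ... | no  _ = 0#

  coeff-eval : ∀ t x → coeff t x ≈ eval (δ t) x
  coeff-eval t []            = refl
  coeff-eval t ((d , s) ∷ x) with s ≟T t
  ... | yes _ = +-cong (sym (*-identityʳ d)) (coeff-eval t x)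
  ... | no  _ = trans (sym (+-identityˡ _)) (+-cong (sym (zeroʳ d)) (coeff-eval t x))

  ≈F-from-eval : ∀ x y → (∀ φ → eval φ x ≈ eval φ y) → x ≈F y
  ≈F-from-eval x y p t = trans (coeff-eval t x) (trans (p (δ t)) (sym (coeff-eval t y)))

  coeff-++ : ∀ t x y → coeff t (x +F y) ≈ coeff t x + coeff t y
  coeff-++ t x y = trans (coeff-eval t (x +F y))
    (trans (Scalar.eval-++ (δ t) x y) (+-cong (sym (coeff-eval t x)) (sym (coeff-eval t y))))

  coeff-*F : ∀ t k x → coeff t (k *F x) ≈ k * coeff t x
  coeff-*F t k x = trans (coeff-eval t (k *F x))
    (trans (Scalar.eval-*F (δ t) k x) (*-congˡ (sym (coeff-eval t x))))

  coeff-negate : ∀ t x → coeff t (-F x) ≈ - coeff t x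
  coeff-negate t x = trans (coeff-eval t (-F x))
    (trans (Scalar.eval-negate (δ t) x) (-‿cong (sym (coeff-eval t x))))

  coeff-head : ∀ d u x → coeff u ((d , u) ∷ x) ≈ d + coeff u x
  coeff-head d u x with u ≟T u
  ... | yes _ = refl
  ... | no  p = contradiction ≡.refl p

  coeff-head-≢ : ∀ {d u t} x → u ≢ t → coeff t ((d , u) ∷ x) ≈ coeff t x
  coeff-head-≢ {u = u} {t} x u≢t with u ≟T t
  ... | yes u≡t = contradiction u≡t u≢t
  ... | no  _   = refl

  remove : Tree γ → F → F
  remove u [] = []
  remove u ((e , v) ∷ x) with v ≟T u
  ... | yes _ = remove u x
  ... | no  _ = (e , v) ∷ remove u x

  length-remove : ∀ u x → length (remove u x) ≤ length x
  length-remove u []            = z≤n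
  length-remove u ((e , v) ∷ x) with v ≟T u
  ... | yes _ = m≤n⇒m≤1+n (length-remove u x)
  ... | no  _ = s≤s (length-remove u x)

  coeff-remove : ∀ u x → coeff u (remove u x) ≈ 0#
  coeff-remove u []            = refl
  coeff-remove u ((e , v) ∷ x) with v ≟T u
  ... | yes _   = coeff-remove u x
  ... | no  v≢u = trans (coeff-head-≢ (remove u x) v≢u) (coeff-remove u x)

  coeff-remove-≢ : ∀ {u t} x → u ≢ t → coeff t (remove u x) ≈ coeff t x
  coeff-remove-≢         []            u≢t = refl
  coeff-remove-≢ {u} {t} ((e , v) ∷ x) u≢t with v ≟T u
  ... | yes ≡.refl = trans (coeff-remove-≢ x u≢t) (sym (coeff-head-≢ x u≢t))
  ... | no  _ with v ≟T t
  ...   | yes _ = +-congˡ (coeff-remove-≢ x u≢t)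
  ...   | no  _ = coeff-remove-≢ x u≢t

module Evaluation≈F {c ℓ m ℓm} (K : Field c ℓ) (γ : ℕ)
                    (M : Module (Field.commutativeRing K) m ℓm) where
  open Field K
  open FreeSpace K γ
  open Module M
  open Evaluation K γ M
  open Coefficients K γ
  open GroupProperties +ᴹ-group using (x∙y⁻¹≈ε⇒x≈y)
  open CommutativeSemigroupProperties (CommutativeMonoid.commutativeSemigroup +ᴹ-commutativeMonoid)
    using (x∙yz≈y∙xz)
  open ≈-Reasoning ≈ᴹ-setoid

  eval-remove : ∀ φ u x → eval φ x ≈ᴹ coeff u x *ₗ φ u +ᴹ eval φ (remove u x)
  eval-remove φ u [] = ≈ᴹ-sym (≈ᴹ-trans (+ᴹ-congʳ (*ₗ-zeroˡ (φ u))) (+ᴹ-identityˡ 0ᴹ))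
  eval-remove φ u ((e , v) ∷ x) with v ≟T u
  ... | yes ≡.refl = begin
    e *ₗ φ v +ᴹ eval φ x                                       ≈⟨ +ᴹ-congˡ (eval-remove φ v x) ⟩
    e *ₗ φ v +ᴹ (coeff v x *ₗ φ v +ᴹ eval φ (remove v x))      ≈⟨ +ᴹ-assoc _ _ _ ⟨
    (e *ₗ φ v +ᴹ coeff v x *ₗ φ v) +ᴹ eval φ (remove v x)      ≈⟨ +ᴹ-congʳ (*ₗ-distribʳ (φ v) e _) ⟨
    (e + coeff v x) *ₗ φ v +ᴹ eval φ (remove v x)              ∎
  ... | no _ = begin
    e *ₗ φ v +ᴹ eval φ x                                       ≈⟨ +ᴹ-congˡ (eval-remove φ u x) ⟩
    e *ₗ φ v +ᴹ (coeff u x *ₗ φ u +ᴹ eval φ (remove u x))      ≈⟨ x∙yz≈y∙xz _ _ _ ⟩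
    coeff u x *ₗ φ u +ᴹ (e *ₗ φ v +ᴹ eval φ (remove u x))      ∎

  -- Removing every occurrence of the head tree u leaves a shorter combination, still ≈F 0F.
  eval-≈F-0F : ∀ φ n x → length x ≤ n → x ≈F 0F → eval φ x ≈ᴹ 0ᴹ
  eval-≈F-0F φ n       []            _               _   = ≈ᴹ-refl
  eval-≈F-0F φ (suc n) ((d , u) ∷ x) (s≤s |x|≤n) x≈0 = begin
    d *ₗ φ u +ᴹ eval φ x                                       ≈⟨ +ᴹ-congˡ (eval-remove φ u x) ⟩
    d *ₗ φ u +ᴹ (coeff u x *ₗ φ u +ᴹ eval φ (remove u x))      ≈⟨ +ᴹ-assoc _ _ _ ⟨
    (d *ₗ φ u +ᴹ coeff u x *ₗ φ u) +ᴹ eval φ (remove u x)      ≈⟨ +ᴹ-congʳ (*ₗ-distribʳ (φ u) d _) ⟨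
    (d + coeff u x) *ₗ φ u +ᴹ eval φ (remove u x)              ≈⟨ +ᴹ-cong (*ₗ-congʳ coeff≈0) eval-rest≈0 ⟩
    0# *ₗ φ u +ᴹ 0ᴹ                                            ≈⟨ +ᴹ-identityʳ _ ⟩
    0# *ₗ φ u                                                  ≈⟨ *ₗ-zeroˡ _ ⟩
    0ᴹ                                                         ∎
    where
    coeff≈0 : d + coeff u x ≈ 0#
    coeff≈0 = trans (sym (coeff-head d u x)) (x≈0 u)
    rest≈0 : remove u x ≈F 0F
    rest≈0 t with u ≟T t
    ... | yes ≡.refl = coeff-remove u x
    ... | no  u≢t    = trans (coeff-remove-≢ x u≢t) (trans (sym (coeff-head-≢ {d} x u≢t)) (x≈0 t))
    eval-rest≈0 : eval φ (remove u x) ≈ᴹ 0ᴹ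
    eval-rest≈0 = eval-≈F-0F φ n (remove u x) (≤-trans (length-remove u x) |x|≤n) rest≈0

  eval-resp : ∀ φ {x y} → x ≈F y → eval φ x ≈ᴹ eval φ y
  eval-resp φ {x} {y} x≈y = x∙y⁻¹≈ε⇒x≈y (eval φ x) (eval φ y) (begin
    eval φ x +ᴹ -ᴹ eval φ y    ≈⟨ +ᴹ-congˡ (eval-negate φ y) ⟨
    eval φ x +ᴹ eval φ (-F y)  ≈⟨ eval-++ φ x (-F y) ⟨
    eval φ (x +F (-F y))       ≈⟨ eval-≈F-0F φ _ (x +F (-F y)) ≤-refl x-y≈0 ⟩
    0ᴹ                         ∎)
    where
    x-y≈0 : (x +F (-F y)) ≈F 0F
    x-y≈0 t = trans (coeff-++ t x (-F y)) (trans (+-cong (x≈y t) (coeff-negate t y)) (-‿inverseʳ _))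

module FreePolydendriform {c ℓ} (K : Field c ℓ) (γ : ℕ) where
  open Field K
  open FreeSpace K γ
  open Coefficients K γ
  open Scalar
  open Evaluation≈F K γ TensorUnit.⟨module⟩ using (eval-resp)

  coefficients : F → Tree γ → Carrier
  coefficients x t = coeff t x

  coefficients-isGroupMonomorphism :
    IsGroupMonomorphism
      (record { Carrier = F ; _≈_ = _≈F_ ; _∙_ = _+F_ ; ε = 0F ; _⁻¹ = -F_ })
      (AbelianGroup.rawGroup (Pointwise.abelianGroup (Tree γ) +-abelianGroup))
      coefficients
  coefficients-isGroupMonomorphism = record
    { isGroupHomomorphism = record
      { isMonoidHomomorphism = record
        { isMagmaHomomorphism = record
          { isRelHomomorphism = record { cong = λ x≈y → x≈y }
          ; homo              = λ x y t → coeff-++ t x y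
          }
        ; ε-homo = λ t → refl
        }
      ; ⁻¹-homo = λ x t → coeff-negate t x
      }
    ; injective = λ x≈y → x≈y
    }

  F-isModule : IsModule commutativeRing _≈F_ _+F_ 0F -F_ _*F_ _*Fʳ_
  F-isModule = IsModuleFromLeft.isModule (record { isLeftModule = record
    { isLeftSemimodule = record
      { +ᴹ-isCommutativeMonoid = isCommutativeMonoid
      ; isPreleftSemimodule = record
        { *ₗ-cong     = λ {k} {k'} {x} {x'} k≈k' x≈x' t →
            trans (coeff-*F t k x) (trans (*-cong k≈k' (x≈x' t)) (sym (coeff-*F t k' x')))
        ; *ₗ-zeroˡ    = λ x t → trans (coeff-*F t 0# x) (zeroˡ _)
        ; *ₗ-distribʳ = λ x k l t → trans (coeff-*F t (k + l) x) (trans (distribʳ _ k l)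
            (sym (trans (coeff-++ t (k *F x) (l *F x)) (+-cong (coeff-*F t k x) (coeff-*F t l x)))))
        ; *ₗ-identityˡ = λ x t → trans (coeff-*F t 1# x) (*-identityˡ _)
        ; *ₗ-assoc    = λ k l x t → trans (coeff-*F t (k * l) x) (trans (*-assoc k l _)
            (sym (trans (coeff-*F t k (l *F x)) (*-congˡ (coeff-*F t l x)))))
        ; *ₗ-zeroʳ    = λ k t → refl
        ; *ₗ-distribˡ = λ k x y t → trans (coeff-*F t k (x +F y)) (trans (*-congˡ (coeff-++ t x y))
            (trans (distribˡ k _ _)
              (sym (trans (coeff-++ t (k *F x) (k *F y)) (+-cong (coeff-*F t k x) (coeff-*F t k y))))))
        }
      }
    ; -ᴹ‿cong    = λ {x} {y} → -F‿cong {x} {y}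
    ; -ᴹ‿inverse = -F‿inverse
    } })
    where
    open IsAbelianGroup (GroupMonomorphism.isAbelianGroup coefficients-isGroupMonomorphism
      (AbelianGroup.isAbelianGroup (Pointwise.abelianGroup (Tree γ) +-abelianGroup)))
      using (isCommutativeMonoid) renaming (⁻¹-cong to -F‿cong; inverse to -F‿inverse)

  module _ (op : Tree γ → Tree γ → List (Tree γ)) where
    open ≈-Reasoning setoid

    private
      ⟪_⟫ : (Tree γ → Carrier) → F → F → Carrier
      ⟪ φ ⟫ x y = eval (λ u → eval (λ v → sumᴹ φ (op u v)) y) x

    bilin-cong : ∀ {x x' y y'} → x ≈F x' → y ≈F y' → bilin op x y ≈F bilin op x' y'
    bilin-cong {x} {x'} {y} {y'} x≈x' y≈y' = ≈F-from-eval (bilin op x y) (bilin op x' y') λ φ → begin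
      eval φ (bilin op x y)    ≈⟨ eval-bilin φ op x y ⟩
      ⟪ φ ⟫ x y                ≈⟨ eval-cong (λ u → eval-resp (λ v → sumᴹ φ (op u v)) {y} {y'} y≈y') x ⟩
      ⟪ φ ⟫ x y'               ≈⟨ eval-resp _ {x} {x'} x≈x' ⟩
      ⟪ φ ⟫ x' y'              ≈⟨ eval-bilin φ op x' y' ⟨
      eval φ (bilin op x' y')  ∎

    bilin-distribʳ : ∀ x y z → bilin op (x +F y) z ≈F (bilin op x z +F bilin op y z)
    bilin-distribʳ x y z = ≈F-from-eval (bilin op (x +F y) z) (bilin op x z +F bilin op y z) λ φ → begin
      eval φ (bilin op (x +F y) z)                  ≈⟨ eval-bilin φ op (x +F y) z ⟩
      ⟪ φ ⟫ (x +F y) z                              ≈⟨ eval-++ _ x y ⟩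
      ⟪ φ ⟫ x z + ⟪ φ ⟫ y z                         ≈⟨ +-cong (eval-bilin φ op x z) (eval-bilin φ op y z) ⟨
      eval φ (bilin op x z) + eval φ (bilin op y z) ≈⟨ eval-++ φ (bilin op x z) (bilin op y z) ⟨
      eval φ (bilin op x z +F bilin op y z)         ∎

    bilin-distribˡ : ∀ x y z → bilin op x (y +F z) ≈F (bilin op x y +F bilin op x z)
    bilin-distribˡ x y z = ≈F-from-eval (bilin op x (y +F z)) (bilin op x y +F bilin op x z) λ φ → begin
      eval φ (bilin op x (y +F z))                  ≈⟨ eval-bilin φ op x (y +F z) ⟩
      ⟪ φ ⟫ x (y +F z)                              ≈⟨ eval-cong (λ u → eval-++ _ y z) x ⟩
      eval (λ u → eval (λ v → sumᴹ φ (op u v)) y + eval (λ v → sumᴹ φ (op u v)) z) x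
                                                    ≈⟨ eval-+ᴹ _ _ x ⟩
      ⟪ φ ⟫ x y + ⟪ φ ⟫ x z                         ≈⟨ +-cong (eval-bilin φ op x y) (eval-bilin φ op x z) ⟨
      eval φ (bilin op x y) + eval φ (bilin op x z) ≈⟨ eval-++ φ (bilin op x y) (bilin op x z) ⟨
      eval φ (bilin op x y +F bilin op x z)         ∎

    bilin-*Fˡ : ∀ k x y → bilin op (k *F x) y ≈F (k *F bilin op x y)
    bilin-*Fˡ k x y = ≈F-from-eval (bilin op (k *F x) y) (k *F bilin op x y) λ φ → begin
      eval φ (bilin op (k *F x) y)  ≈⟨ eval-bilin φ op (k *F x) y ⟩
      ⟪ φ ⟫ (k *F x) y              ≈⟨ eval-*F _ k x ⟩
      k * ⟪ φ ⟫ x y                 ≈⟨ *-congˡ (eval-bilin φ op x y) ⟨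
      k * eval φ (bilin op x y)     ≈⟨ eval-*F φ k (bilin op x y) ⟨
      eval φ (k *F bilin op x y)    ∎

    bilin-*Fʳ : ∀ k x y → bilin op x (k *F y) ≈F (k *F bilin op x y)
    bilin-*Fʳ k x y = ≈F-from-eval (bilin op x (k *F y)) (k *F bilin op x y) λ φ → begin
      eval φ (bilin op x (k *F y))                       ≈⟨ eval-bilin φ op x (k *F y) ⟩
      ⟪ φ ⟫ x (k *F y)                                   ≈⟨ eval-cong (λ u → eval-*F _ k y) x ⟩
      eval (λ u → k * eval (λ v → sumᴹ φ (op u v)) y) x  ≈⟨ eval-linear (*ₗ-isLinear k) _ x ⟩
      k * ⟪ φ ⟫ x y                                      ≈⟨ *-congˡ (eval-bilin φ op x y) ⟨
      k * eval φ (bilin op x y)                          ≈⟨ eval-*F φ k (bilin op x y) ⟨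
      eval φ (k *F bilin op x y)                         ∎

    bilin-isBilinear : IsBilinear K γ _≈F_ _+F_ _*F_ (bilin op)
    bilin-isBilinear = (λ {x} {x'} {y} {y'} → bilin-cong {x} {x'} {y} {y'})
                     , bilin-distribʳ , bilin-distribˡ , bilin-*Fˡ , bilin-*Fʳ

  module _ (a a' : Fin γ) (x y z : F) where
    open ≈-Reasoning setoid

    F-axiom₁ : precF a (succF a' x y) z ≈F succF a' x (precF a y z)
    F-axiom₁ = ≈F-from-eval (precF a (succF a' x y) z) (succF a' x (precF a y z)) λ φ → begin
      eval φ (precF a (succF a' x y) z)                   ≈⟨ eval-bilin-bilinˡ (precT a) (succT a') φ x y z ⟩
      eval₃ (λ u v w → precTˡ a (succT a' u v) w) φ x y z ≈⟨ eval₃-↭ (axiom₁ᵀ a a') φ x y z ⟩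
      eval₃ (λ u v w → succTʳ a' u (precT a v w)) φ x y z ≈⟨ eval-bilin-bilinʳ (succT a') (precT a) φ x y z ⟨
      eval φ (succF a' x (precF a y z))                   ∎

    F-axiom₂ : precF a (precF a' x y) z ≈F
               (precF (a ⊓ a') x (precF a y z) +F precF (a ⊓ a') x (succF a' y z))
    F-axiom₂ = ≈F-from-eval (precF a (precF a' x y) z)
                            (precF (a ⊓ a') x (precF a y z) +F precF (a ⊓ a') x (succF a' y z)) λ φ → begin
      eval φ (precF a (precF a' x y) z)
        ≈⟨ eval-bilin-bilinˡ (precT a) (precT a') φ x y z ⟩
      eval₃ (λ u v w → precTˡ a (precT a' u v) w) φ x y z
        ≈⟨ eval₃-↭ (λ u v w → ↭-trans (axiom₂ᵀ a a' u v w)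
              (↭-reflexive (concatMap-++ (precT (a ⊓ a') u) (precT a v w) (succT a' v w)))) φ x y z ⟩
      eval₃ (λ u v w → precTʳ (a ⊓ a') u (precT a v w) ++ precTʳ (a ⊓ a') u (succT a' v w)) φ x y z
        ≈⟨ eval₃-++ (λ u v w → precTʳ (a ⊓ a') u (precT a v w))
                    (λ u v w → precTʳ (a ⊓ a') u (succT a' v w)) φ x y z ⟩
      eval₃ (λ u v w → precTʳ (a ⊓ a') u (precT a v w)) φ x y z
        + eval₃ (λ u v w → precTʳ (a ⊓ a') u (succT a' v w)) φ x y z
        ≈⟨ +-cong (eval-bilin-bilinʳ (precT (a ⊓ a')) (precT a) φ x y z)
                  (eval-bilin-bilinʳ (precT (a ⊓ a')) (succT a') φ x y z) ⟨
      eval φ (precF (a ⊓ a') x (precF a y z)) + eval φ (precF (a ⊓ a') x (succF a' y z))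
        ≈⟨ eval-++ φ (precF (a ⊓ a') x (precF a y z)) (precF (a ⊓ a') x (succF a' y z)) ⟨
      eval φ (precF (a ⊓ a') x (precF a y z) +F precF (a ⊓ a') x (succF a' y z)) ∎

    F-axiom₃ : (succF (a ⊓ a') (precF a' x y) z +F succF (a ⊓ a') (succF a x y) z) ≈F
               succF a x (succF a' y z)
    F-axiom₃ = ≈F-from-eval (succF (a ⊓ a') (precF a' x y) z +F succF (a ⊓ a') (succF a x y) z)
                            (succF a x (succF a' y z)) λ φ → begin
      eval φ (succF (a ⊓ a') (precF a' x y) z +F succF (a ⊓ a') (succF a x y) z)
        ≈⟨ eval-++ φ (succF (a ⊓ a') (precF a' x y) z) (succF (a ⊓ a') (succF a x y) z) ⟩
      eval φ (succF (a ⊓ a') (precF a' x y) z) + eval φ (succF (a ⊓ a') (succF a x y) z)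
        ≈⟨ +-cong (eval-bilin-bilinˡ (succT (a ⊓ a')) (precT a') φ x y z)
                  (eval-bilin-bilinˡ (succT (a ⊓ a')) (succT a) φ x y z) ⟩
      eval₃ (λ u v w → succTˡ (a ⊓ a') (precT a' u v) w) φ x y z
        + eval₃ (λ u v w → succTˡ (a ⊓ a') (succT a u v) w) φ x y z
        ≈⟨ eval₃-++ (λ u v w → succTˡ (a ⊓ a') (precT a' u v) w)
                    (λ u v w → succTˡ (a ⊓ a') (succT a u v) w) φ x y z ⟨
      eval₃ (λ u v w → succTˡ (a ⊓ a') (precT a' u v) w ++ succTˡ (a ⊓ a') (succT a u v) w) φ x y z
        ≈⟨ eval₃-↭ (λ u v w → ↭-trans
              (↭-reflexive (≡.sym (concatMap-++ (λ p → succT (a ⊓ a') p w) (precT a' u v) (succT a u v))))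
              (axiom₃ᵀ a a' u v w)) φ x y z ⟩
      eval₃ (λ u v w → succTʳ a u (succT a' v w)) φ x y z
        ≈⟨ eval-bilin-bilinʳ (succT a) (succT a') φ x y z ⟨
      eval φ (succF a x (succF a' y z)) ∎

  F-isPolydendriform : IsPolydendriform K γ _≈F_ _+F_ _*F_ precF succF
  F-isPolydendriform = record
    { ≺-bilinear = λ a → bilin-isBilinear (precT a)
    ; ≻-bilinear = λ a → bilin-isBilinear (succT a)
    ; axiom₁     = F-axiom₁
    ; axiom₂     = F-axiom₂
    ; axiom₃     = F-axiom₃
    }

module UniversalProperty {c ℓ m ℓm} (K : Field c ℓ) (γ : ℕ)
                         (A : PolydendriformAlgebra K γ m ℓm) (e : PolydendriformAlgebra.Carrierᴹ A) where
  open Field K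
  open FreeSpace K γ
  open PolydendriformAlgebra A
  open IsPolydendriform isPolydendriform
  open Evaluation K γ module′
  open Evaluation≈F K γ module′ using (eval-resp)
  open GroupProperties +ᴹ-group using (identityˡ-unique)
  open ≈-Reasoning ≈ᴹ-setoid
  module ≺ a = Bilinear (≺-bilinear a)
  module ≻ a = Bilinear (≻-bilinear a)

  _≺⟨_⟩_ _≻⟨_⟩_ : Carrierᴹ → Fin γ → Carrierᴹ → Carrierᴹ
  u ≺⟨ a ⟩ v = _≺_ a u v
  u ≻⟨ a ⟩ v = _≻_ a u v

  mutual
    ⟦_⟧ : Tree γ → Carrierᴹ
    ⟦ node l r ⟧ = graftˡ l (graftʳ r e)

    graftˡ : Child γ → Carrierᴹ → Carrierᴹ
    graftˡ leaf       w = w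
    graftˡ (edge x t) w = ⟦ t ⟧ ≻⟨ x ⟩ w

    graftʳ : Child γ → Carrierᴹ → Carrierᴹ
    graftʳ leaf       w = w
    graftʳ (edge y t) w = w ≺⟨ y ⟩ ⟦ t ⟧

  graftˡ-isLinear : ∀ l → IsLinear (graftˡ l)
  graftˡ-isLinear leaf =
    record { congᴹ = λ p → p ; +ᴹ-homo = λ _ _ → ≈ᴹ-refl ; *ₗ-homo = λ _ _ → ≈ᴹ-refl }
  graftˡ-isLinear (edge x t) = ≻.∘-isLinearʳ x ⟦ t ⟧

  module graftˡ l = IsLinear (graftˡ-isLinear l)

  graftˡ-≺ : ∀ l a w v → graftˡ l w ≺⟨ a ⟩ v ≈ᴹ graftˡ l (w ≺⟨ a ⟩ v)
  graftˡ-≺ leaf       a w v = ≈ᴹ-refl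
  graftˡ-≺ (edge x t) a w v = axiom₁ a x ⟦ t ⟧ w v

  mutual
    sumᴹ-precT : ∀ a u v → sumᴹ ⟦_⟧ (precT a u v) ≈ᴹ ⟦ u ⟧ ≺⟨ a ⟩ ⟦ v ⟧
    sumᴹ-precT a (node l leaf) v = ≈ᴹ-trans (+ᴹ-identityʳ _) (≈ᴹ-sym (graftˡ-≺ l a e ⟦ v ⟧))
    sumᴹ-precT a (node l (edge y t)) v = begin
      sumᴹ ⟦_⟧ (map (λ u → node l (edge (a ⊓ y) u)) ts)
        ≈⟨ sumᴹ-map ⟦_⟧ _ ts ⟩
      sumᴹ (λ u → graftˡ l (e ≺⟨ a ⊓ y ⟩ ⟦ u ⟧)) ts
        ≈⟨ sumᴹ-linear (∘-isLinear (graftˡ-isLinear l) (≺.∘-isLinearʳ (a ⊓ y) e)) ⟦_⟧ ts ⟩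
      graftˡ l (e ≺⟨ a ⊓ y ⟩ sumᴹ ⟦_⟧ ts)
        ≈⟨ graftˡ.congᴹ l (≺.∘-cong (a ⊓ y) ≈ᴹ-refl (≈ᴹ-trans
             (sumᴹ-++ ⟦_⟧ (precT a t v) (succT y t v)) (+ᴹ-cong (sumᴹ-precT a t v) (sumᴹ-succT y t v)))) ⟩
      graftˡ l (e ≺⟨ a ⊓ y ⟩ (⟦ t ⟧ ≺⟨ a ⟩ ⟦ v ⟧ +ᴹ ⟦ t ⟧ ≻⟨ y ⟩ ⟦ v ⟧))
        ≈⟨ graftˡ.congᴹ l (IsLinear.+ᴹ-homo (≺.∘-isLinearʳ (a ⊓ y) e) _ _) ⟩
      graftˡ l (e ≺⟨ a ⊓ y ⟩ (⟦ t ⟧ ≺⟨ a ⟩ ⟦ v ⟧) +ᴹ e ≺⟨ a ⊓ y ⟩ (⟦ t ⟧ ≻⟨ y ⟩ ⟦ v ⟧))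
        ≈⟨ graftˡ.congᴹ l (axiom₂ a y e ⟦ t ⟧ ⟦ v ⟧) ⟨
      graftˡ l ((e ≺⟨ y ⟩ ⟦ t ⟧) ≺⟨ a ⟩ ⟦ v ⟧)
        ≈⟨ graftˡ-≺ l a _ ⟦ v ⟧ ⟨
      graftˡ l (e ≺⟨ y ⟩ ⟦ t ⟧) ≺⟨ a ⟩ ⟦ v ⟧ ∎
      where ts = precT a t v ++ succT y t v

    sumᴹ-succT : ∀ a u v → sumᴹ ⟦_⟧ (succT a u v) ≈ᴹ ⟦ u ⟧ ≻⟨ a ⟩ ⟦ v ⟧
    sumᴹ-succT a u (node leaf r) = +ᴹ-identityʳ _
    sumᴹ-succT a u (node (edge x t) r) = begin
      sumᴹ ⟦_⟧ (map (λ w → node (edge (a ⊓ x) w) r) ts)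
        ≈⟨ sumᴹ-map ⟦_⟧ _ ts ⟩
      sumᴹ (λ w → ⟦ w ⟧ ≻⟨ a ⊓ x ⟩ graftʳ r e) ts
        ≈⟨ sumᴹ-linear (≻.∘-isLinearˡ (a ⊓ x) (graftʳ r e)) ⟦_⟧ ts ⟩
      sumᴹ ⟦_⟧ ts ≻⟨ a ⊓ x ⟩ graftʳ r e
        ≈⟨ ≻.∘-cong (a ⊓ x) (≈ᴹ-trans (sumᴹ-++ ⟦_⟧ (succT a u t) (precT x u t))
             (+ᴹ-cong (sumᴹ-succT a u t) (sumᴹ-precT x u t))) ≈ᴹ-refl ⟩
      (⟦ u ⟧ ≻⟨ a ⟩ ⟦ t ⟧ +ᴹ ⟦ u ⟧ ≺⟨ x ⟩ ⟦ t ⟧) ≻⟨ a ⊓ x ⟩ graftʳ r e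
        ≈⟨ IsLinear.+ᴹ-homo (≻.∘-isLinearˡ (a ⊓ x) (graftʳ r e)) _ _ ⟩
      (⟦ u ⟧ ≻⟨ a ⟩ ⟦ t ⟧) ≻⟨ a ⊓ x ⟩ graftʳ r e +ᴹ (⟦ u ⟧ ≺⟨ x ⟩ ⟦ t ⟧) ≻⟨ a ⊓ x ⟩ graftʳ r e
        ≈⟨ +ᴹ-comm _ _ ⟩
      (⟦ u ⟧ ≺⟨ x ⟩ ⟦ t ⟧) ≻⟨ a ⊓ x ⟩ graftʳ r e +ᴹ (⟦ u ⟧ ≻⟨ a ⟩ ⟦ t ⟧) ≻⟨ a ⊓ x ⟩ graftʳ r e
        ≈⟨ axiom₃ a x ⟦ u ⟧ ⟦ t ⟧ (graftʳ r e) ⟩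
      ⟦ u ⟧ ≻⟨ a ⟩ (⟦ t ⟧ ≻⟨ x ⟩ graftʳ r e) ∎
      where ts = succT a u t ++ precT x u t

  eval⟦⟧ : F → Carrierᴹ
  eval⟦⟧ = eval ⟦_⟧

  eval⟦⟧-isMorphism : IsMorphism K γ A eval⟦⟧
  eval⟦⟧-isMorphism =
      (λ {x} {y} → eval-resp ⟦_⟧ {x} {y})
    , eval-++ ⟦_⟧
    , eval-*F ⟦_⟧
    , (λ a → ≺.eval-bilin-∘ a ⟦_⟧ (sumᴹ-precT a))
    , (λ a → ≻.eval-bilin-∘ a ⟦_⟧ (sumᴹ-succT a))

  eval⟦⟧-gen : eval⟦⟧ gen ≈ᴹ e
  eval⟦⟧-gen = ≈ᴹ-trans (+ᴹ-identityʳ _) (*ₗ-identityˡ e)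

  single : Tree γ → F
  single t = (1# , t) ∷ []

  single-≈F : ∀ {k k' t} → k ≈ k' → ((k , t) ∷ []) ≈F ((k' , t) ∷ [])
  single-≈F {t = t} k≈k' s with t ≟T s
  ... | yes _ = +-congʳ k≈k'
  ... | no  _ = refl

  morphism≈eval∘single : ∀ g → IsMorphism K γ A g → ∀ x → g x ≈ᴹ eval (λ t → g (single t)) x
  morphism≈eval∘single g (_ , g-+F , _) [] = identityˡ-unique (g []) (g []) (≈ᴹ-sym (g-+F [] []))
  morphism≈eval∘single g gm@(g-cong , g-+F , g-*F , _) ((d , t) ∷ x) = begin
    g ((d , t) ∷ x)                       ≈⟨ g-+F ((d , t) ∷ []) x ⟩
    g ((d , t) ∷ []) +ᴹ g x               ≈⟨ +ᴹ-cong (g-cong (single-≈F {t = t} (sym (*-identityʳ d))))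
                                                     (morphism≈eval∘single g gm x) ⟩
    g (d *F single t) +ᴹ eval _ x         ≈⟨ +ᴹ-congʳ (g-*F d (single t)) ⟩
    d *ₗ g (single t) +ᴹ eval _ x         ∎

  morphism-single≈⟦⟧ : ∀ g → IsMorphism K γ A g → g gen ≈ᴹ e → ∀ t → g (single t) ≈ᴹ ⟦ t ⟧
  morphism-single≈⟦⟧ g (g-cong , _ , _ , g-≺ , g-≻) g≈e = go
    where
    go : ∀ t → g (single t) ≈ᴹ ⟦ t ⟧
    go (node leaf leaf) = g≈e
    go (node leaf (edge y t₂)) = begin
      g (single (node leaf (edge y t₂)))
        ≈⟨ g-cong (single-≈F {t = node leaf (edge y t₂)} (sym (*-identityʳ 1#))) ⟩
      g (precF y gen (single t₂))
        ≈⟨ g-≺ y gen (single t₂) ⟩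
      g gen ≺⟨ y ⟩ g (single t₂)
        ≈⟨ ≺.∘-cong y g≈e (go t₂) ⟩
      e ≺⟨ y ⟩ ⟦ t₂ ⟧ ∎
    go (node (edge x t₁) leaf) = begin
      g (single (node (edge x t₁) leaf))
        ≈⟨ g-cong (single-≈F {t = node (edge x t₁) leaf} (sym (*-identityʳ 1#))) ⟩
      g (succF x (single t₁) gen)
        ≈⟨ g-≻ x (single t₁) gen ⟩
      g (single t₁) ≻⟨ x ⟩ g gen
        ≈⟨ ≻.∘-cong x (go t₁) g≈e ⟩
      ⟦ t₁ ⟧ ≻⟨ x ⟩ e ∎
    go (node (edge x t₁) (edge y t₂)) = begin
      g (single (node (edge x t₁) (edge y t₂)))
        ≈⟨ g-cong (single-≈F {t = node (edge x t₁) (edge y t₂)}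
                    (sym (trans (*-identityˡ _) (*-identityʳ 1#)))) ⟩
      g (succF x (single t₁) (precF y gen (single t₂)))
        ≈⟨ g-≻ x (single t₁) _ ⟩
      g (single t₁) ≻⟨ x ⟩ g (precF y gen (single t₂))
        ≈⟨ ≻.∘-cong x (go t₁) (g-≺ y gen (single t₂)) ⟩
      ⟦ t₁ ⟧ ≻⟨ x ⟩ (g gen ≺⟨ y ⟩ g (single t₂))
        ≈⟨ ≻.∘-cong x ≈ᴹ-refl (≺.∘-cong y g≈e (go t₂)) ⟩
      ⟦ t₁ ⟧ ≻⟨ x ⟩ (e ≺⟨ y ⟩ ⟦ t₂ ⟧) ∎

  eval⟦⟧-unique : ∀ g → IsMorphism K γ A g → g gen ≈ᴹ e → ∀ x → g x ≈ᴹ eval⟦⟧ x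
  eval⟦⟧-unique g g-mor g≈e x =
    ≈ᴹ-trans (morphism≈eval∘single g g-mor x) (eval-cong (morphism-single≈⟦⟧ g g-mor g≈e) x)

theorem2p2p3 : ∀ {c ℓ m ℓm : Level} (K : Field c ℓ) → CharacteristicZero K → (γ : ℕ) →
    let open FreeSpace K γ in
      IsModule (Field.commutativeRing K) _≈F_ _+F_ 0F -F_ _*F_ _*Fʳ_
    × IsPolydendriform K γ _≈F_ _+F_ _*F_ precF succF
    × ((A : PolydendriformAlgebra K γ m ℓm) (e : PolydendriformAlgebra.Carrierᴹ A) →
        Σ (F → PolydendriformAlgebra.Carrierᴹ A) λ f →
            IsMorphism K γ A f
          × PolydendriformAlgebra._≈ᴹ_ A (f gen) e
          × ((g : F → PolydendriformAlgebra.Carrierᴹ A) → IsMorphism K γ A g →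
              PolydendriformAlgebra._≈ᴹ_ A (g gen) e →
              ∀ x → PolydendriformAlgebra._≈ᴹ_ A (g x) (f x)))
theorem2p2p3 K _ γ =
    FreePolydendriform.F-isModule K γ
  , FreePolydendriform.F-isPolydendriform K γ
  , λ A e → let open UniversalProperty K γ A e in
      eval⟦⟧ , eval⟦⟧-isMorphism , eval⟦⟧-gen , eval⟦⟧-unique
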